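{- Let $\beta,\gamma,\varrho\in\mathbb F$ and $P(x,y)=x^2-\beta xy+y^2-\gamma(x+y)-\varrho$. Let $\theta_0,\dots,\theta_d\in\mathbb F$ be mutually distinct and $(\beta,\gamma,\varrho)$-recurrent, i.e. $\theta_{i-1}^2-\beta\theta_{i-1}\theta_i+\theta_i^2-\gamma(\theta_{i-1}+\theta_i)=\varrho$ for $1\le i\le d$. Then: (i) $P(x,\theta_j)=(x-\theta_{j-1})(x-\theta_{j+1})$ for $1\le j\le d-1$; (ii) for $0\le i,j\le d$, $P(\theta_i,\theta_j)=0$ implies $|i-j|=1$ or $i,j\in\{0,d\}$.
   Context: $\mathbb F$ is a field and $d\ge0$ an integer; $x,y$ are indeterminates. -}

module Defs where

open import Level using (Level; suc; _⊔_)
open import Algebra.Bundles using (CommutativeRing)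
open import Data.Product using (∃; _×_)
open import Data.List using (List; []; _∷_)
open import Data.Nat using (ℕ; zero; suc)
open import Relation.Nullary using (¬_)

record Field (c ℓ : Level) : Set (Level.suc (c ⊔ ℓ)) where
  field
    commutativeRing : CommutativeRing c ℓ
  open CommutativeRing commutativeRing public
  field
    1≉0     : ¬ (1# ≈ 0#)
    inverse : ∀ x → ¬ (x ≈ 0#) → ∃ λ y → x * y ≈ 1#

module Polynomials {c ℓ} (F : Field c ℓ) where
  open Field F

  -- univariate polynomials over F as coefficient lists, lowest degree first
  Poly : Set c
  Poly = List Carrier

  coeff : Poly → ℕ → Carrier
  coeff []       _       = 0#
  coeff (a ∷ p)  zero    = a
  coeff (a ∷ p)  (suc n) = coeff p n

  infix 4 _≈ₚ_
  _≈ₚ_ : Poly → Poly → Set ℓ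
  p ≈ₚ q = ∀ n → coeff p n ≈ coeff q n

  infixl 6 _+ₚ_ _-ₚ_
  infixl 7 _*ₚ_ _·ₚ_

  _+ₚ_ : Poly → Poly → Poly
  []      +ₚ q       = q
  (a ∷ p) +ₚ []      = a ∷ p
  (a ∷ p) +ₚ (b ∷ q) = (a + b) ∷ (p +ₚ q)

  _·ₚ_ : Carrier → Poly → Poly
  a ·ₚ []      = []
  a ·ₚ (b ∷ p) = (a * b) ∷ (a ·ₚ p)

  -ₚ_ : Poly → Poly
  -ₚ p = (- 1#) ·ₚ p

  _-ₚ_ : Poly → Poly → Poly
  p -ₚ q = p +ₚ (-ₚ q)

  _*ₚ_ : Poly → Poly → Poly
  []      *ₚ q = []
  (a ∷ p) *ₚ q = (a ·ₚ q) +ₚ (0# ∷ (p *ₚ q))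

  C : Carrier → Poly
  C a = a ∷ []

  X : Poly
  X = 0# ∷ 1# ∷ []

module Recurrent {c ℓ} (F : Field c ℓ) (β γ ϱ : Field.Carrier F) where
  open Field F
  open Polynomials F

  P : Carrier → Carrier → Carrier
  P a b = a * a - β * a * b + b * b - γ * (a + b) - ϱ

  Px : Carrier → Poly
  Px b = X *ₚ X -ₚ (β * b) ·ₚ X +ₚ C (b * b) -ₚ γ ·ₚ (X +ₚ C b) -ₚ C ϱ

-- P(x, b) is a monic quadratic in x, so two distinct roots a, e of P(·, b) determine it as
-- (x − a)(x − e) (Vieta). For an interior index j, θ_{j−1} and θ_{j+1} are two distinct roots
-- of P(·, θ_j): the first by recurrence, the second by recurrence and the symmetry of P. This
-- gives (i), and shows that P(θ_i, θ_j) = 0 with j interior forces θ_i ∈ {θ_{j−1}, θ_{j+1}};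
-- by symmetry the same holds with i interior, which leaves only pairs of endpoints.
module Submission where

open import Defs
open import Algebra.Bundles using (CommutativeRing)
open import Algebra.Solver.Ring.AlmostCommutativeRing
  using (fromCommutativeRing; _-Raw-AlmostCommutative⟶_; Induced-equivalence)
import Algebra.Solver.Ring as RingSolver
open import Data.Integer as ℤ using (ℤ; +_; -[1+_]; _⊖_)
import Data.Integer.Properties as ℤ
import Data.Sign as Sign
open import Data.List using ([]; _∷_)
open import Data.Maybe using (just; nothing)
open import Data.Nat as ℕ using (ℕ; zero; suc; _≤_)
open import Data.Nat.Properties using (<⇒≤; ≤-trans; m≤n+m; m≢1+n+m; ≤∧≢⇒<; +-suc)
open import Data.Sum using (_⊎_; inj₁; inj₂)
open import Relation.Binary.Definitions using (WeaklyDecidable)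
open import Relation.Binary.PropositionalEquality using (_≡_; cong) renaming (refl to ≡-refl; sym to ≡-sym)
open import Relation.Nullary using (¬_; yes; no)

-- The solver compares normal forms by evaluation, so its coefficients must compute: they are
-- integers, sent into R by n ↦ n × 1#. The optimised multiple is used because 1 × 1# is then
-- 1# itself, so the constants of the solver match literal occurrences of 1# in goals.
module IntegerCoefficientRingSolver {c ℓ} (R : CommutativeRing c ℓ) where
  open CommutativeRing R
  open import Algebra.Properties.Ring ring
    using (-‿distribˡ-*; -‿distribʳ-*; -0#≈0#; -‿involutive; -‿+-comm; xyx⁻¹≈y)
  open import Algebra.Properties.Semiring.Mult.TCOptimised semiring using (_×_; 1+×; ×-homo-+; ×1-homo-*)
  open import Relation.Binary.Reasoning.Setoid setoid

  ⟦_⟧ℤ : ℤ → Carrier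
  ⟦ + n ⟧ℤ      = n × 1#
  ⟦ -[1+ n ] ⟧ℤ = - (suc n × 1#)

  [x+a]-[x+b]≈a-b : ∀ x a b → (x + a) - (x + b) ≈ a - b
  [x+a]-[x+b]≈a-b x a b = begin
    (x + a) + - (x + b)    ≈⟨ +-congˡ (sym (-‿+-comm x b)) ⟩
    (x + a) + (- x + - b)  ≈⟨ sym (+-assoc (x + a) (- x) (- b)) ⟩
    (x + a) + - x + - b    ≈⟨ +-congʳ (xyx⁻¹≈y x a) ⟩
    a - b                  ∎

  ⊖-homo : ∀ m n → ⟦ m ⊖ n ⟧ℤ ≈ m × 1# - n × 1#
  ⊖-homo zero    zero    = sym (-‿inverseʳ 0#)
  ⊖-homo zero    (suc n) = sym (+-identityˡ _)
  ⊖-homo (suc m) zero    = sym (trans (+-congˡ -0#≈0#) (+-identityʳ _))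
  ⊖-homo (suc m) (suc n) rewrite ℤ.[1+m]⊖[1+n]≡m⊖n m n = begin
    ⟦ m ⊖ n ⟧ℤ                         ≈⟨ ⊖-homo m n ⟩
    m × 1# - n × 1#                    ≈⟨ sym ([x+a]-[x+b]≈a-b 1# (m × 1#) (n × 1#)) ⟩
    (1# + m × 1#) - (1# + n × 1#)      ≈⟨ sym (+-cong (1+× m 1#) (-‿cong (1+× n 1#))) ⟩
    suc m × 1# - suc n × 1#            ∎

  +-homo : ∀ i j → ⟦ i ℤ.+ j ⟧ℤ ≈ ⟦ i ⟧ℤ + ⟦ j ⟧ℤ
  +-homo (+ m)    (+ n)    = ×-homo-+ 1# m n
  +-homo (+ m)    -[1+ n ] = ⊖-homo m (suc n)
  +-homo -[1+ m ] (+ n)    = trans (⊖-homo n (suc m)) (+-comm _ _)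
  +-homo -[1+ m ] -[1+ n ] = begin
    - (suc (suc (m ℕ.+ n)) × 1#)       ≡⟨ cong (λ k → - (suc k × 1#)) (≡-sym (+-suc m n)) ⟩
    - ((suc m ℕ.+ suc n) × 1#)         ≈⟨ -‿cong (×-homo-+ 1# (suc m) (suc n)) ⟩
    - (suc m × 1# + suc n × 1#)        ≈⟨ sym (-‿+-comm _ _) ⟩
    - (suc m × 1#) + - (suc n × 1#)    ∎

  ◃-homo⁺ : ∀ n → ⟦ Sign.+ ℤ.◃ n ⟧ℤ ≈ n × 1#
  ◃-homo⁺ zero    = refl
  ◃-homo⁺ (suc n) = refl

  ◃-homo⁻ : ∀ n → ⟦ Sign.- ℤ.◃ n ⟧ℤ ≈ - (n × 1#)
  ◃-homo⁻ zero    = sym -0#≈0#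
  ◃-homo⁻ (suc n) = refl

  -x*-y≈x*y : ∀ x y → - x * - y ≈ x * y
  -x*-y≈x*y x y = begin
    - x * - y      ≈⟨ sym (-‿distribʳ-* (- x) y) ⟩
    - (- x * y)    ≈⟨ -‿cong (sym (-‿distribˡ-* x y)) ⟩
    - - (x * y)    ≈⟨ -‿involutive (x * y) ⟩
    x * y          ∎

  *-homo : ∀ i j → ⟦ i ℤ.* j ⟧ℤ ≈ ⟦ i ⟧ℤ * ⟦ j ⟧ℤ
  *-homo (+ m) (+ n) =
    trans (◃-homo⁺ (m ℕ.* n)) (×1-homo-* m n)
  *-homo (+ m) -[1+ n ] =
    trans (◃-homo⁻ (m ℕ.* suc n)) (trans (-‿cong (×1-homo-* m (suc n))) (-‿distribʳ-* _ _))
  *-homo -[1+ m ] (+ n) =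
    trans (◃-homo⁻ (suc m ℕ.* n)) (trans (-‿cong (×1-homo-* (suc m) n)) (-‿distribˡ-* _ _))
  *-homo -[1+ m ] -[1+ n ] =
    trans (◃-homo⁺ (suc m ℕ.* suc n)) (trans (×1-homo-* (suc m) (suc n)) (sym (-x*-y≈x*y _ _)))

  -‿homo : ∀ i → ⟦ ℤ.- i ⟧ℤ ≈ - ⟦ i ⟧ℤ
  -‿homo (+ zero)  = sym -0#≈0#
  -‿homo (+ suc n) = refl
  -‿homo -[1+ n ]  = sym (-‿involutive _)

  ℤ⟶R : ℤ.+-*-rawRing -Raw-AlmostCommutative⟶ fromCommutativeRing R
  ℤ⟶R = record
    { ⟦_⟧ = ⟦_⟧ℤ ; +-homo = +-homo ; *-homo = *-homo ; -‿homo = -‿homo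
    ; 0-homo = refl ; 1-homo = refl }

  ≡⇒induced : WeaklyDecidable (Induced-equivalence ℤ⟶R)
  ≡⇒induced i j with i ℤ.≟ j
  ... | yes ≡-refl = just refl
  ... | no _       = nothing

  open RingSolver ℤ.+-*-rawRing (fromCommutativeRing R) ℤ⟶R ≡⇒induced public
    using (solve; _:=_; _:+_; _:*_; _:-_; :-_; con; Polynomial)

  :0# :1# : ∀ {n} → Polynomial n
  :0# = con (+ 0)
  :1# = con (+ 1)

open import Data.Product using (_×_; _,_; ∃; proj₁; proj₂)

module FieldProperties {c ℓ} (F : Field c ℓ) where
  open Field F
  open import Algebra.Properties.Ring ring using (x∙y⁻¹≈ε⇒x≈y)
  open IntegerCoefficientRingSolver commutativeRing
  open import Relation.Binary.Reasoning.Setoid setoid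

  x≉0∧x*y≈0⇒y≈0 : ∀ {x y} → ¬ x ≈ 0# → x * y ≈ 0# → y ≈ 0#
  x≉0∧x*y≈0⇒y≈0 {x} {y} x≉0 x*y≈0 with inverse x x≉0
  ... | x⁻¹ , x*x⁻¹≈1 = begin
    y                ≈⟨ sym (*-identityˡ y) ⟩
    1# * y           ≈⟨ *-congʳ (sym x*x⁻¹≈1) ⟩
    (x * x⁻¹) * y    ≈⟨ solve 3 (λ x x⁻¹ y → (x :* x⁻¹) :* y := x⁻¹ :* (x :* y)) refl x x⁻¹ y ⟩
    x⁻¹ * (x * y)    ≈⟨ *-congˡ x*y≈0 ⟩
    x⁻¹ * 0#         ≈⟨ zeroʳ x⁻¹ ⟩
    0#               ∎

  x≉y⇒x-y≉0 : ∀ {x y} → ¬ x ≈ y → ¬ x - y ≈ 0#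
  x≉y⇒x-y≉0 {x} {y} x≉y x-y≈0 = x≉y (x∙y⁻¹≈ε⇒x≈y x y x-y≈0)

  [x-a][x-e]≈0∧x≉a⇒x≈e : ∀ {x a e} → (x - a) * (x - e) ≈ 0# → ¬ x ≈ a → x ≈ e
  [x-a][x-e]≈0∧x≉a⇒x≈e {x} {a} {e} product≈0 x≉a =
    x∙y⁻¹≈ε⇒x≈y x e (x≉0∧x*y≈0⇒y≈0 (x≉y⇒x-y≉0 x≉a) product≈0)

  quadratic : Carrier → Carrier → Carrier → Carrier
  quadratic s q x = x * x - s * x + q

  vieta : ∀ {s q a e} → ¬ a ≈ e → quadratic s q a ≈ 0# → quadratic s q e ≈ 0#
        → a + e ≈ s × a * e ≈ q
  vieta {s} {q} {a} {e} a≉e Qa≈0 Qe≈0 =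
    x∙y⁻¹≈ε⇒x≈y _ _ [a+e]-s≈0 , x∙y⁻¹≈ε⇒x≈y _ _ a*e-q≈0
    where
    [a+e]-s≈0 : (a + e) - s ≈ 0#
    [a+e]-s≈0 = x≉0∧x*y≈0⇒y≈0 (x≉y⇒x-y≉0 a≉e) (begin
      (a - e) * ((a + e) - s)
        ≈⟨ solve 4 (λ a e s q → (a :- e) :* ((a :+ e) :- s)
                      := (a :* a :- s :* a :+ q) :- (e :* e :- s :* e :+ q)) refl a e s q ⟩
      quadratic s q a - quadratic s q e  ≈⟨ +-cong Qa≈0 (-‿cong Qe≈0) ⟩
      0# - 0#                            ≈⟨ -‿inverseʳ 0# ⟩
      0#                                 ∎)

    a*e-q≈0 : a * e - q ≈ 0#
    a*e-q≈0 = begin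
      a * e - q
        ≈⟨ solve 4 (λ a e s q → a :* e :- q
                      := a :* ((a :+ e) :- s) :- (a :* a :- s :* a :+ q)) refl a e s q ⟩
      a * ((a + e) - s) - quadratic s q a  ≈⟨ +-cong (trans (*-congˡ [a+e]-s≈0) (zeroʳ a)) (-‿cong Qa≈0) ⟩
      0# - 0#                              ≈⟨ -‿inverseʳ 0# ⟩
      0#                                   ∎

  quadratic-factor : ∀ {s q a e} → a + e ≈ s → a * e ≈ q
                   → ∀ x → quadratic s q x ≈ (x - a) * (x - e)
  quadratic-factor {s} {q} {a} {e} a+e≈s a*e≈q x = begin
    x * x - s * x + q            ≈⟨ +-cong (+-congˡ (-‿cong (*-congʳ (sym a+e≈s)))) (sym a*e≈q) ⟩
    x * x - (a + e) * x + a * e  ≈⟨ solve 3 (λ x a e → x :* x :- (a :+ e) :* x :+ a :* e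
                                               := (x :- a) :* (x :- e)) refl x a e ⟩
    (x - a) * (x - e)            ∎

module QuadraticPolynomials {c ℓ} (F : Field c ℓ) where
  open Field F
  open Polynomials F
  open IntegerCoefficientRingSolver commutativeRing

  quadraticₚ : Carrier → Carrier → Poly
  quadraticₚ s q = q ∷ - s ∷ 1# ∷ []

  quadraticₚ-cong : ∀ {s s′ q q′} → s ≈ s′ → q ≈ q′ → quadraticₚ s q ≈ₚ quadraticₚ s′ q′
  quadraticₚ-cong s≈s′ q≈q′ zero                = q≈q′
  quadraticₚ-cong s≈s′ q≈q′ (suc zero)          = -‿cong s≈s′
  quadraticₚ-cong s≈s′ q≈q′ (suc (suc n))       = refl

  [X-a][X-e]≈quadraticₚ : ∀ a e → (X -ₚ C a) *ₚ (X -ₚ C e) ≈ₚ quadraticₚ (a + e) (a * e)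
  [X-a][X-e]≈quadraticₚ a e zero =
    solve 2 (λ a e → (:0# :+ :- :1# :* a) :* (:0# :+ :- :1# :* e) :+ :0#
                     := a :* e) refl a e
  [X-a][X-e]≈quadraticₚ a e (suc zero) =
    solve 2 (λ a e → (:0# :+ :- :1# :* a) :* :1# :+ (:1# :* (:0# :+ :- :1# :* e) :+ :0#)
                     := :- (a :+ e)) refl a e
  [X-a][X-e]≈quadraticₚ a e (suc (suc zero)) = *-identityˡ 1#
  [X-a][X-e]≈quadraticₚ a e (suc (suc (suc n))) = refl

module RecurrencePolynomial {c ℓ} (F : Field c ℓ) (β γ ϱ : Field.Carrier F) where
  open Field F
  open Polynomials F
  open Recurrent F β γ ϱ
  open IntegerCoefficientRingSolver commutativeRing
  open FieldProperties F
  open QuadraticPolynomials F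
  open import Relation.Binary.Reasoning.Setoid setoid

  Distinct : ℕ → (ℕ → Carrier) → Set ℓ
  Distinct d θ = ∀ i j → i ≤ d → j ≤ d → θ i ≈ θ j → i ≡ j

  IsRecurrent : ℕ → (ℕ → Carrier) → Set ℓ
  IsRecurrent d θ = ∀ i → suc i ≤ d
    → θ i * θ i - β * θ i * θ (suc i) + θ (suc i) * θ (suc i) - γ * (θ i + θ (suc i)) ≈ ϱ

  P-sym : ∀ x y → P x y ≈ P y x
  P-sym x y = solve 5 (λ x y β γ ϱ → x :* x :- β :* x :* y :+ y :* y :- γ :* (x :+ y) :- ϱ
                                   := y :* y :- β :* y :* x :+ x :* x :- γ :* (y :+ x) :- ϱ)
                      refl x y β γ ϱ

  P-as-quadratic : ∀ x b → P x b ≈ quadratic (β * b + γ) (b * b - γ * b - ϱ) x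
  P-as-quadratic x b =
    solve 5 (λ x b β γ ϱ → x :* x :- β :* x :* b :+ b :* b :- γ :* (x :+ b) :- ϱ
                         := x :* x :- (β :* b :+ γ) :* x :+ (b :* b :- γ :* b :- ϱ))
            refl x b β γ ϱ

  Px≈quadraticₚ : ∀ b → Px b ≈ₚ quadraticₚ (β * b + γ) (b * b - γ * b - ϱ)
  Px≈quadraticₚ b zero =
    solve 4 (λ b β γ ϱ → :0# :* :0# :+ :0# :+ :- :1# :* (β :* b :* :0#) :+ b :* b
                         :+ :- :1# :* (γ :* (:0# :+ b)) :+ :- :1# :* ϱ
                       := b :* b :- γ :* b :- ϱ) refl b β γ ϱ
  Px≈quadraticₚ b (suc zero) =
    solve 3 (λ b β γ → :0# :* :1# :+ (:1# :* :0# :+ :0#) :+ :- :1# :* (β :* b :* :1#)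
                       :+ :- :1# :* (γ :* :1#)
                     := :- (β :* b :+ γ)) refl b β γ
  Px≈quadraticₚ b (suc (suc zero))    = *-identityˡ 1#
  Px≈quadraticₚ b (suc (suc (suc n))) = refl

  module _ {a b e} (a≉e : ¬ a ≈ e) (Pab≈0 : P a b ≈ 0#) (Peb≈0 : P e b ≈ 0#) where
    private
      roots : a + e ≈ β * b + γ × a * e ≈ b * b - γ * b - ϱ
      roots = vieta a≉e (trans (sym (P-as-quadratic a b)) Pab≈0) (trans (sym (P-as-quadratic e b)) Peb≈0)

    P-factor : ∀ x → P x b ≈ (x - a) * (x - e)
    P-factor x = trans (P-as-quadratic x b) (quadratic-factor (proj₁ roots) (proj₂ roots) x)

    Px-factor : Px b ≈ₚ (X -ₚ C a) *ₚ (X -ₚ C e)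
    Px-factor n = begin
      coeff (Px b) n                                             ≈⟨ Px≈quadraticₚ b n ⟩
      coeff (quadraticₚ (β * b + γ) (b * b - γ * b - ϱ)) n       ≈⟨ quadraticₚ-cong (sym (proj₁ roots)) (sym (proj₂ roots)) n ⟩
      coeff (quadraticₚ (a + e) (a * e)) n                       ≈⟨ sym ([X-a][X-e]≈quadraticₚ a e n) ⟩
      coeff ((X -ₚ C a) *ₚ (X -ₚ C e)) n                         ∎

module RecurrentSequence {c ℓ} (F : Field c ℓ) (β γ ϱ : Field.Carrier F) (d : ℕ) (θ : ℕ → Field.Carrier F)
  (distinct : RecurrencePolynomial.Distinct F β γ ϱ d θ)
  (recurrent : RecurrencePolynomial.IsRecurrent F β γ ϱ d θ)
  where
  open Field F
  open Polynomials F
  open Recurrent F β γ ϱ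
  open import Algebra.Properties.Ring ring using (x≈y⇒x∙y⁻¹≈ε)
  open FieldProperties F
  open RecurrencePolynomial F β γ ϱ using (P-sym; P-factor; Px-factor)

  P-consecutive≈0 : ∀ i → suc i ≤ d → P (θ i) (θ (suc i)) ≈ 0#
  P-consecutive≈0 i i<d = x≈y⇒x∙y⁻¹≈ε (recurrent i i<d)

  module _ (k : ℕ) (k+2≤d : suc (suc k) ≤ d) where
    private
      k≤d : k ≤ d
      k≤d = ≤-trans (m≤n+m k 2) k+2≤d

      θk≉θk+2 : ¬ θ k ≈ θ (suc (suc k))
      θk≉θk+2 θk≈θk+2 = m≢1+n+m k (distinct k (suc (suc k)) k≤d k+2≤d θk≈θk+2)

      Pk+2≈0 : P (θ (suc (suc k))) (θ (suc k)) ≈ 0#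
      Pk+2≈0 = trans (P-sym _ _) (P-consecutive≈0 (suc k) k+2≤d)

    P-factor-interior : ∀ x → P x (θ (suc k)) ≈ (x - θ k) * (x - θ (suc (suc k)))
    P-factor-interior = P-factor θk≉θk+2 (P-consecutive≈0 k (<⇒≤ k+2≤d)) Pk+2≈0

    Px-factor-interior : Px (θ (suc k)) ≈ₚ (X -ₚ C (θ k)) *ₚ (X -ₚ C (θ (suc (suc k))))
    Px-factor-interior = Px-factor θk≉θk+2 (P-consecutive≈0 k (<⇒≤ k+2≤d)) Pk+2≈0

    roots-at-interior : ∀ i → i ≤ d → P (θ i) (θ (suc k)) ≈ 0# → i ≡ k ⊎ i ≡ suc (suc k)
    roots-at-interior i i≤d P≈0 with i ℕ.≟ k
    ... | yes i≡k = inj₁ i≡k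
    ... | no  i≢k = inj₂ (distinct i (suc (suc k)) i≤d k+2≤d
                          ([x-a][x-e]≈0∧x≉a⇒x≈e (trans (sym (P-factor-interior (θ i))) P≈0)
                                                  (λ θi≈θk → i≢k (distinct i k i≤d k≤d θi≈θk))))

  endpoint-or-interior : ∀ j → j ≤ d → (j ≡ 0 ⊎ j ≡ d) ⊎ ∃ λ k → j ≡ suc k × suc (suc k) ≤ d
  endpoint-or-interior zero    j≤d = inj₁ (inj₁ ≡-refl)
  endpoint-or-interior (suc k) j≤d with suc k ℕ.≟ d
  ... | yes j≡d = inj₁ (inj₂ j≡d)
  ... | no  j≢d = inj₂ (k , ≡-refl , ≤∧≢⇒< j≤d j≢d)

  P≈0⇒adjacent-or-endpoints : ∀ i j → i ≤ d → j ≤ d → P (θ i) (θ j) ≈ 0#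
    → (i ≡ suc j ⊎ j ≡ suc i) ⊎ ((i ≡ 0 ⊎ i ≡ d) × (j ≡ 0 ⊎ j ≡ d))
  P≈0⇒adjacent-or-endpoints i j i≤d j≤d P≈0
    with endpoint-or-interior j j≤d | endpoint-or-interior i i≤d
  ... | inj₂ (k , ≡-refl , k+2≤d) | _ with roots-at-interior k k+2≤d i i≤d P≈0
  ...   | inj₁ ≡-refl = inj₁ (inj₂ ≡-refl)
  ...   | inj₂ ≡-refl = inj₁ (inj₁ ≡-refl)
  P≈0⇒adjacent-or-endpoints i j i≤d j≤d P≈0 | inj₁ j-end | inj₁ i-end = inj₂ (i-end , j-end)
  P≈0⇒adjacent-or-endpoints i j i≤d j≤d P≈0 | inj₁ _ | inj₂ (k , ≡-refl , k+2≤d)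
    with roots-at-interior k k+2≤d j j≤d (trans (P-sym _ _) P≈0)
  ...   | inj₁ ≡-refl = inj₁ (inj₁ ≡-refl)
  ...   | inj₂ ≡-refl = inj₁ (inj₂ ≡-refl)

proposition14p2 : ∀ {c ℓ} (F : Field c ℓ) (β γ ϱ : Field.Carrier F) (d : ℕ) (θ : ℕ → Field.Carrier F)
    → let open Field F in let open Polynomials F in let open Recurrent F β γ ϱ in
      (∀ i j → i ≤ d → j ≤ d → θ i ≈ θ j → i ≡ j)
    → (∀ i → suc i ≤ d → θ i * θ i - β * θ i * θ (suc i) + θ (suc i) * θ (suc i) - γ * (θ i + θ (suc i)) ≈ ϱ)
    → (∀ k → suc (suc k) ≤ d → Px (θ (suc k)) ≈ₚ (X -ₚ C (θ k)) *ₚ (X -ₚ C (θ (suc (suc k)))))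
      × (∀ i j → i ≤ d → j ≤ d → P (θ i) (θ j) ≈ 0#
          → (i ≡ suc j ⊎ j ≡ suc i) ⊎ ((i ≡ 0 ⊎ i ≡ d) × (j ≡ 0 ⊎ j ≡ d)))
proposition14p2 F β γ ϱ d θ distinct recurrent = Px-factor-interior , P≈0⇒adjacent-or-endpoints
  where open RecurrentSequence F β γ ϱ d θ distinct recurrent
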